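{- Let $G=(V,E)$ be a graph and $T\subseteq V$, and consider any one of the following three problems: finding a minimum $T$-vertex cover, a minimum $T$-feedback vertex set, or a minimum odd $T$-cycle transversal of $G$. If $S\subseteq V$ is a minimum solution (i.e., a solution of minimum cardinality) for $(G,T)$ for that problem, then $|S\setminus T|\leq |T\setminus S|$.
   Context: For a graph $G=(V,E)$ and $T\subseteq V$: a set $S\subseteq V$ is a $T$-vertex cover if every edge incident to a vertex of $T$ has an end-vertex in $S$; a $T$-cycle is a cycle containing a vertex of $T$, and $S$ is a $T$-feedback vertex set if every $T$-cycle contains a vertex of $S$; an odd $T$-cycle is a $T$-cycle with an odd number of vertices, and $S$ is an odd $T$-cycle transversal if every odd $T$-cycle contains a vertex of $S$. -}

module Defs where

open import Data.Nat using (ℕ; suc; _≤_; _<_)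
open import Data.Nat using (_%_)
open import Data.Fin using (Fin; zero; suc; inject₁; fromℕ)
open import Data.Fin.Subset using (Subset; _∈_; ∣_∣)
open import Data.Product using (Σ; ∃; _×_; _,_)
open import Data.Sum using (_⊎_)
open import Function.Definitions using (Injective)
open import Relation.Binary.PropositionalEquality using (_≡_)
open import Relation.Nullary using (¬_)
open import Level using (0ℓ)

record Graph (n : ℕ) : Set₁ where
  field
    Adj   : Fin n → Fin n → Set
    sym   : ∀ {u v} → Adj u v → Adj v u
    irrefl : ∀ {u} → ¬ Adj u u
open Graph public

-- A cycle v₀ v₁ … v_k (k+1 ≥ 3 distinct vertices) with v_i ~ v_{i+1}
-- and v_k ~ v₀.
record Cycle {n : ℕ} (G : Graph n) : Set where
  field
    k       : ℕ
    long    : 2 ≤ k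
    vert    : Fin (suc k) → Fin n
    distinct : Injective _≡_ _≡_ vert
    step    : (i : Fin k) → Adj G (vert (inject₁ i)) (vert (suc i))
    close   : Adj G (vert (fromℕ k)) (vert zero)
open Cycle public

cycleLength : ∀ {n} {G : Graph n} → Cycle G → ℕ
cycleLength C = suc (k C)

Meets : ∀ {n} {G : Graph n} → Cycle G → Subset n → Set
Meets C X = ∃ λ i → vert C i ∈ X

IsTVertexCover : ∀ {n} → Graph n → Subset n → Subset n → Set
IsTVertexCover G T S =
  ∀ u v → Adj G u v → (u ∈ T ⊎ v ∈ T) → (u ∈ S ⊎ v ∈ S)

IsTFeedbackVertexSet : ∀ {n} → Graph n → Subset n → Subset n → Set
IsTFeedbackVertexSet G T S = (C : Cycle G) → Meets C T → Meets C S

IsOddTCycleTransversal : ∀ {n} → Graph n → Subset n → Subset n → Set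
IsOddTCycleTransversal G T S =
  (C : Cycle G) → cycleLength C % 2 ≡ 1 → Meets C T → Meets C S

data Problem : Set where
  TVertexCover TFeedbackVertexSet OddTCycleTransversal : Problem

IsSolution : Problem → ∀ {n} → Graph n → Subset n → Subset n → Set
IsSolution TVertexCover         = IsTVertexCover
IsSolution TFeedbackVertexSet   = IsTFeedbackVertexSet
IsSolution OddTCycleTransversal = IsOddTCycleTransversal

IsMinimumSolution : Problem → ∀ {n} → Graph n → Subset n → Subset n → Set
IsMinimumSolution P G T S =
  IsSolution P G T S × (∀ S′ → IsSolution P G T S′ → ∣ S ∣ ≤ ∣ S′ ∣)

-- T itself meets every edge and every cycle that meets T, so it is a
-- solution of each of the three problems; hence a minimum solution S has
-- |S| ≤ |T|, and removing the common part S ∩ T from both sides leaves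
-- |S ∖ T| ≤ |T ∖ S|.
module Submission where

open import Defs hiding (sym)
open import Data.Nat using (ℕ; _≤_; _+_; suc)
open import Data.Nat.Properties using (+-suc; +-monoˡ-≤; +-cancelˡ-≤; module ≤-Reasoning)
open import Data.Fin.Subset using (Subset; ∣_∣; _─_; inside; outside)
open import Data.Vec using ([]; _∷_)
open import Data.Product using (_,_)
open import Function using (id)
open import Relation.Binary.PropositionalEquality using (_≡_; refl; cong; trans; sym)

∣p∣+∣q─p∣≡∣q∣+∣p─q∣ : ∀ {n} (p q : Subset n) → ∣ p ∣ + ∣ q ─ p ∣ ≡ ∣ q ∣ + ∣ p ─ q ∣
∣p∣+∣q─p∣≡∣q∣+∣p─q∣ []            []            = refl
∣p∣+∣q─p∣≡∣q∣+∣p─q∣ (inside  ∷ p) (inside  ∷ q) = cong suc (∣p∣+∣q─p∣≡∣q∣+∣p─q∣ p q)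
∣p∣+∣q─p∣≡∣q∣+∣p─q∣ (inside  ∷ p) (outside ∷ q) =
  trans (cong suc (∣p∣+∣q─p∣≡∣q∣+∣p─q∣ p q)) (sym (+-suc ∣ q ∣ ∣ p ─ q ∣))
∣p∣+∣q─p∣≡∣q∣+∣p─q∣ (outside ∷ p) (inside  ∷ q) =
  trans (+-suc ∣ p ∣ ∣ q ─ p ∣) (cong suc (∣p∣+∣q─p∣≡∣q∣+∣p─q∣ p q))
∣p∣+∣q─p∣≡∣q∣+∣p─q∣ (outside ∷ p) (outside ∷ q) = ∣p∣+∣q─p∣≡∣q∣+∣p─q∣ p q

∣p∣≤∣q∣⇒∣p─q∣≤∣q─p∣ : ∀ {n} (p q : Subset n) → ∣ p ∣ ≤ ∣ q ∣ → ∣ p ─ q ∣ ≤ ∣ q ─ p ∣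
∣p∣≤∣q∣⇒∣p─q∣≤∣q─p∣ p q ∣p∣≤∣q∣ = +-cancelˡ-≤ ∣ q ∣ _ _ (begin
  ∣ q ∣ + ∣ p ─ q ∣  ≡⟨ sym (∣p∣+∣q─p∣≡∣q∣+∣p─q∣ p q) ⟩
  ∣ p ∣ + ∣ q ─ p ∣  ≤⟨ +-monoˡ-≤ ∣ q ─ p ∣ ∣p∣≤∣q∣ ⟩
  ∣ q ∣ + ∣ q ─ p ∣  ∎)
  where open ≤-Reasoning

T-isSolution : ∀ P {n} (G : Graph n) (T : Subset n) → IsSolution P G T T
T-isSolution TVertexCover         G T = λ _ _ _ → id
T-isSolution TFeedbackVertexSet   G T = λ _ → id
T-isSolution OddTCycleTransversal G T = λ _ _ → id

lemma2 : (P : Problem) (n : ℕ) (G : Graph n) (T S : Subset n) →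
    IsMinimumSolution P G T S → ∣ S ─ T ∣ ≤ ∣ T ─ S ∣
lemma2 P n G T S (_ , minimal) =
  ∣p∣≤∣q∣⇒∣p─q∣≤∣q─p∣ S T (minimal T (T-isSolution P G T))
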